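{- For the Riordan array $M_2=\left(\frac{1-2x}{1-x},\frac{x}{1-x}\right)$, its vertical half is $V_2=(1,xc(x))$ and its horizontal half is $H_2=(1,xc(x)^2)$.
   Context: All power series are formal power series with complex coefficients. A Riordan array is a pair $(g(x),f(x))$ of power series with $g(0)\neq 0$, $f(0)=0$, $f'(0)\neq 0$; it is identified with the infinite lower triangular matrix $(t_{n,k})_{n,k\ge 0}$, $t_{n,k}=[x^n]g(x)f(x)^k$. The vertical half of a Riordan array with matrix $(t_{n,k})$ is the matrix whose $(n,k)$ entry is $t_{2n-k,n}$ (with $t_{i,j}=0$ for $j>i$); the horizontal half is the matrix whose $(n,k)$ entry is $t_{2n,n+k}$. Here $c(x)=\frac{1-\sqrt{1-4x}}{2x}$ is the generating function of the Catalan numbers. -}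

module Defs where

open import Data.Nat as ℕ using (ℕ; zero; suc; _∸_; _≤ᵇ_)
open import Data.Nat.Combinatorics using (_C_)
open import Data.Integer using (ℤ; +_; -_; _+_; _*_; 0ℤ; 1ℤ)
open import Data.Bool using (if_then_else_)

-- Formal power series, represented by their coefficient sequences.
-- (All series occurring in the theorem have integer coefficients, and
--  ℤ ⊆ ℂ, so we work over ℤ.)
PS : Set
PS = ℕ → ℤ

sumTo : ℕ → (ℕ → ℤ) → ℤ
sumTo zero    a = a 0
sumTo (suc n) a = sumTo n a + a (suc n)

oneS : PS
oneS zero    = 1ℤ
oneS (suc _) = 0ℤ

xS : PS
xS 1 = 1ℤ
xS _ = 0ℤ

oneMinus2x : PS
oneMinus2x 0 = 1ℤ
oneMinus2x 1 = - (+ 2)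
oneMinus2x _ = 0ℤ

-- 1/(1-x) = Σ x^n (the multiplicative inverse of 1 - x)
geom : PS
geom _ = 1ℤ

_⊛_ : PS → PS → PS
(a ⊛ b) n = sumTo n (λ i → a i * b (n ∸ i))

infixl 7 _⊛_

_^ˢ_ : PS → ℕ → PS
f ^ˢ zero  = oneS
f ^ˢ suc k = f ⊛ (f ^ˢ k)

catalan : ℕ → ℕ
catalan n = ((2 ℕ.* n) C n) ℕ./ suc n

cS : PS
cS n = + catalan n

record Riordan : Set where
  constructor ⟨_,_⟩
  field
    g : PS
    f : PS

entry : Riordan → ℕ → ℕ → ℤ
entry ⟨ g , f ⟩ n k = if k ≤ᵇ n then (g ⊛ (f ^ˢ k)) n else 0ℤ

Matrix : Set
Matrix = ℕ → ℕ → ℤ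

verticalHalf : Matrix → Matrix
verticalHalf t n k = if k ≤ᵇ (2 ℕ.* n) then t ((2 ℕ.* n) ∸ k) n else 0ℤ

horizontalHalf : Matrix → Matrix
horizontalHalf t n k = t (2 ℕ.* n) (n ℕ.+ k)

M₂ : Riordan
M₂ = ⟨ oneMinus2x ⊛ geom , xS ⊛ geom ⟩

V₂ : Riordan
V₂ = ⟨ oneS , xS ⊛ cS ⟩

H₂ : Riordan
H₂ = ⟨ oneS , xS ⊛ (cS ⊛ cS) ⟩

-- Let t n k be the (n,k) entry of M₂ = (g₂, f₂) with f₂ = x/(1-x). Since g₂ = 1 - f₂ and
-- [xⁿ] f₂ᵏ = C(n-1,k-1), t n k = C(n-1,k-1) - C(n-1,k): so t obeys Pascal's rule
-- t(n+1,k+1) = t(n,k) + t(n,k+1), is 1 on the diagonal and vanishes at (2m+2, m+1) by the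
-- symmetry of binomials. Reindexed as ballot m r = t(r+2m, r+m) it obeys
-- ballot(m+1,r+1) = ballot(m+1,r) + ballot(m,r+2), i.e. its column generating functions satisfy
-- B_{r+1} = B_r + x B_{r+2}, whence B_r B_s = B_{r+s}. As t(2m+1,m+1) = C(2m,m) - C(2m,m+1) is
-- the m-th Catalan number, B₁ = c and B_r = cʳ. Hence the (k+m, k) entries of the vertical and
-- horizontal halves, ballot m k and ballot m (2k), are [x^(k+m)] (x c)ᵏ and [x^(k+m)] (x c²)ᵏ;
-- above the diagonal all four matrices vanish.

module Submission where

open import Defs
open import Data.Nat using (ℕ)
open import Data.Product using (_×_)
open import Relation.Binary.PropositionalEquality using (_≡_)

open import Data.Bool using (true; false; if_then_else_)
open import Data.Empty using (⊥-elim)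
open import Data.Integer using (ℤ; +_; _+_; _-_; _*_; 0ℤ; 1ℤ)
import Data.Integer.Properties as ℤ
open import Algebra.Properties.CommutativeSemigroup ℤ.+-commutativeSemigroup
  using () renaming (interchange to +-interchange)
open import Data.Integer.Tactic.RingSolver renaming (solve-∀ to ℤ-solve-∀)
open import Data.Nat as ℕ using (zero; suc; _∸_; _≤_; _<_; z≤n; s≤s; _≤ᵇ_; _≤?_)
import Data.Nat.Properties as ℕ
open import Data.Nat.Tactic.RingSolver renaming (solve-∀ to ℕ-solve-∀)
open import Data.Nat.Combinatorics
  using (_C_; nCk+nC[k+1]≡[n+1]C[k+1]; k>n⇒nCk≡0; nCn≡1; nC1≡n; nCk≡nC[n∸k])
open import Data.Nat.DivMod using (_/_; m*n/n≡m)
open import Data.Product using (_,_)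
open import Function using (_∘_)
open import Relation.Nullary using (yes; no)
open import Relation.Binary.PropositionalEquality
  using (refl; sym; trans; cong; cong₂; subst; _≗_; module ≡-Reasoning)

open ≡-Reasoning

infixl 6 _+ˢ_

_+ˢ_ : PS → PS → PS
(a +ˢ b) n = a n + b n

sumTo-cong : ∀ n {a b : ℕ → ℤ} → (∀ {i} → i ≤ n → a i ≡ b i) → sumTo n a ≡ sumTo n b
sumTo-cong zero    a≡b = a≡b z≤n
sumTo-cong (suc n) a≡b = cong₂ _+_ (sumTo-cong n (a≡b ∘ ℕ.m≤n⇒m≤1+n)) (a≡b ℕ.≤-refl)

sumTo-zero : ∀ n {a : ℕ → ℤ} → (∀ {i} → i ≤ n → a i ≡ 0ℤ) → sumTo n a ≡ 0ℤ
sumTo-zero zero    a≡0 = a≡0 z≤n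
sumTo-zero (suc n) a≡0 = cong₂ _+_ (sumTo-zero n (a≡0 ∘ ℕ.m≤n⇒m≤1+n)) (a≡0 ℕ.≤-refl)

sumTo-distrib-+ : ∀ n (a b : ℕ → ℤ) → sumTo n (a +ˢ b) ≡ sumTo n a + sumTo n b
sumTo-distrib-+ zero    a b = refl
sumTo-distrib-+ (suc n) a b = begin
  sumTo n (a +ˢ b) + (a (suc n) + b (suc n))
    ≡⟨ cong (_+ (a (suc n) + b (suc n))) (sumTo-distrib-+ n a b) ⟩
  (sumTo n a + sumTo n b) + (a (suc n) + b (suc n))
    ≡⟨ +-interchange (sumTo n a) (sumTo n b) (a (suc n)) (b (suc n)) ⟩
  (sumTo n a + a (suc n)) + (sumTo n b + b (suc n)) ∎

sumTo-suc : ∀ n (a : ℕ → ℤ) → sumTo (suc n) a ≡ a 0 + sumTo n (a ∘ suc)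
sumTo-suc zero    a = refl
sumTo-suc (suc n) a = trans (cong (_+ a (suc (suc n))) (sumTo-suc n a)) (ℤ.+-assoc (a 0) _ _)

⊛-cong : ∀ {a a′ b b′ : PS} → a ≗ a′ → b ≗ b′ → a ⊛ b ≗ a′ ⊛ b′
⊛-cong a≗a′ b≗b′ n = sumTo-cong n (λ {i} _ → cong₂ _*_ (a≗a′ i) (b≗b′ (n ∸ i)))

⊛-congˡ : ∀ (a : PS) {b b′ : PS} → b ≗ b′ → a ⊛ b ≗ a ⊛ b′
⊛-congˡ a = ⊛-cong {a = a} (λ _ → refl)

⊛-congʳ : ∀ {a a′ : PS} (b : PS) → a ≗ a′ → a ⊛ b ≗ a′ ⊛ b
⊛-congʳ b a≗a′ = ⊛-cong {b = b} a≗a′ (λ _ → refl)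

⊛-distribʳ-+ˢ : ∀ (a b c : PS) → (a +ˢ b) ⊛ c ≗ a ⊛ c +ˢ b ⊛ c
⊛-distribʳ-+ˢ a b c n =
  trans (sumTo-cong n (λ {i} _ → ℤ.*-distribʳ-+ (c (n ∸ i)) (a i) (b i))) (sumTo-distrib-+ n _ _)

⊛-identityˡ : ∀ (a : PS) → oneS ⊛ a ≗ a
⊛-identityˡ a zero    = ℤ.*-identityˡ (a 0)
⊛-identityˡ a (suc n) = begin
  sumTo (suc n) (λ i → oneS i * a (suc n ∸ i))
    ≡⟨ sumTo-suc n _ ⟩
  1ℤ * a (suc n) + sumTo n (λ i → 0ℤ * a (n ∸ i))
    ≡⟨ cong₂ _+_ (ℤ.*-identityˡ (a (suc n))) (sumTo-zero n (λ {i} _ → ℤ.*-zeroˡ (a (n ∸ i)))) ⟩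
  a (suc n) + 0ℤ
    ≡⟨ ℤ.+-identityʳ (a (suc n)) ⟩
  a (suc n) ∎

⊛-sucˡ : ∀ (a b : PS) → a 0 ≡ 0ℤ → ∀ n → (a ⊛ b) (suc n) ≡ ((a ∘ suc) ⊛ b) n
⊛-sucˡ a b a₀≡0 n = begin
  (a ⊛ b) (suc n)                        ≡⟨ sumTo-suc n _ ⟩
  a 0 * b (suc n) + ((a ∘ suc) ⊛ b) n    ≡⟨ cong (λ z → z * b (suc n) + ((a ∘ suc) ⊛ b) n) a₀≡0 ⟩
  0ℤ * b (suc n) + ((a ∘ suc) ⊛ b) n     ≡⟨ ℤ.+-identityˡ _ ⟩
  ((a ∘ suc) ⊛ b) n ∎

⊛-sucʳ : ∀ (a b : PS) → b 0 ≡ 0ℤ → ∀ n → (a ⊛ b) (suc n) ≡ (a ⊛ (b ∘ suc)) n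
⊛-sucʳ a b b₀≡0 n = begin
  sumTo n (λ i → a i * b (suc n ∸ i)) + a (suc n) * b (n ∸ n)
    ≡⟨ cong₂ _+_ (sumTo-cong n (λ {i} i≤n → cong (λ j → a i * b j) (ℕ.+-∸-assoc 1 i≤n)))
                 (cong (λ j → a (suc n) * b j) (ℕ.n∸n≡0 n)) ⟩
  (a ⊛ (b ∘ suc)) n + a (suc n) * b 0
    ≡⟨ cong (λ z → (a ⊛ (b ∘ suc)) n + z) (trans (cong (a (suc n) *_) b₀≡0) (ℤ.*-zeroʳ (a (suc n)))) ⟩
  (a ⊛ (b ∘ suc)) n + 0ℤ
    ≡⟨ ℤ.+-identityʳ _ ⟩
  (a ⊛ (b ∘ suc)) n ∎

⊛-shiftʳ : ∀ k (a b : PS) → (∀ {j} → j < k → b j ≡ 0ℤ) →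
           ∀ m → (a ⊛ b) (k ℕ.+ m) ≡ (a ⊛ (b ∘ (k ℕ.+_))) m
⊛-shiftʳ zero    a b _   m = refl
⊛-shiftʳ (suc k) a b b≡0 m = trans (⊛-sucʳ a b (b≡0 (s≤s z≤n)) (k ℕ.+ m))
                                   (⊛-shiftʳ k a (b ∘ suc) (b≡0 ∘ s≤s) m)

geom⊛-suc : ∀ (b : PS) n → (geom ⊛ b) (suc n) ≡ b (suc n) + (geom ⊛ b) n
geom⊛-suc b n = trans (sumTo-suc n _) (cong (_+ (geom ⊛ b) n) (ℤ.*-identityˡ (b (suc n))))

xS⊛-zero : ∀ (h : PS) → (xS ⊛ h) 0 ≡ 0ℤ
xS⊛-zero h = ℤ.*-zeroˡ (h 0)

xS⊛-suc : ∀ (h : PS) → (xS ⊛ h) ∘ suc ≗ h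
xS⊛-suc h n = trans (⊛-sucˡ xS h refl n) (trans (⊛-congʳ h xS∘suc≗oneS n) (⊛-identityˡ h n))
  where
  xS∘suc≗oneS : xS ∘ suc ≗ oneS
  xS∘suc≗oneS zero    = refl
  xS∘suc≗oneS (suc _) = refl

[xS⊛h]⊛g-suc : ∀ (h g : PS) n → ((xS ⊛ h) ⊛ g) (suc n) ≡ (h ⊛ g) n
[xS⊛h]⊛g-suc h g n = trans (⊛-sucˡ (xS ⊛ h) g (xS⊛-zero h) n) (⊛-congʳ g (xS⊛-suc h) n)

xS⊛h^ˢ-vanishes : ∀ (h : PS) k {j} → j < k → ((xS ⊛ h) ^ˢ k) j ≡ 0ℤ
xS⊛h^ˢ-vanishes h (suc k) {zero}  _ =
  trans (cong (_* ((xS ⊛ h) ^ˢ k) 0) (xS⊛-zero h)) (ℤ.*-zeroˡ (((xS ⊛ h) ^ˢ k) 0))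
xS⊛h^ˢ-vanishes h (suc k) {suc j} (s≤s j<k) =
  trans ([xS⊛h]⊛g-suc h ((xS ⊛ h) ^ˢ k) j) (sumTo-zero j term≡0)
  where
  term≡0 : ∀ {i} → i ≤ j → h i * ((xS ⊛ h) ^ˢ k) (j ∸ i) ≡ 0ℤ
  term≡0 {i} _ = trans (cong (h i *_) (xS⊛h^ˢ-vanishes h k (ℕ.≤-<-trans (ℕ.m∸n≤m j i) j<k)))
                       (ℤ.*-zeroʳ (h i))

xS⊛h^ˢ-shift : ∀ (h : PS) k → ((xS ⊛ h) ^ˢ k) ∘ (k ℕ.+_) ≗ h ^ˢ k
xS⊛h^ˢ-shift h zero    m = refl
xS⊛h^ˢ-shift h (suc k) m = begin
  ((xS ⊛ h) ⊛ (xS ⊛ h) ^ˢ k) (suc (k ℕ.+ m))    ≡⟨ [xS⊛h]⊛g-suc h ((xS ⊛ h) ^ˢ k) (k ℕ.+ m) ⟩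
  (h ⊛ (xS ⊛ h) ^ˢ k) (k ℕ.+ m)                ≡⟨ ⊛-shiftʳ k h ((xS ⊛ h) ^ˢ k) (xS⊛h^ˢ-vanishes h k) m ⟩
  (h ⊛ ((xS ⊛ h) ^ˢ k ∘ (k ℕ.+_))) m           ≡⟨ ⊛-congˡ h (xS⊛h^ˢ-shift h k) m ⟩
  (h ⊛ h ^ˢ k) m                               ∎

if-≤ᵇ : ∀ {A : Set} {m n} {x y : A} → m ≤ n → (if m ≤ᵇ n then x else y) ≡ x
if-≤ᵇ {m = m} {n} m≤n with m ≤ᵇ n | ℕ.≤⇒≤ᵇ m≤n
... | true | _ = refl

if-≰ᵇ : ∀ {A : Set} {m n} {x y : A} → n < m → (if m ≤ᵇ n then x else y) ≡ y
if-≰ᵇ {m = m} {n} n<m with m ≤ᵇ n | ℕ.≤ᵇ⇒≤ m n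
... | false | _   = refl
... | true  | m≤n = ⊥-elim (ℕ.<⇒≱ n<m (m≤n _))

entry-upper : ∀ R {n k} → n < k → entry R n k ≡ 0ℤ
entry-upper R = if-≰ᵇ

verticalHalf-upper : ∀ R {n k} → n < k → verticalHalf (entry R) n k ≡ 0ℤ
verticalHalf-upper R {n} {k} n<k with k ≤? 2 ℕ.* n
... | no  k≰2n = if-≰ᵇ (ℕ.≰⇒> k≰2n)
... | yes k≤2n = trans (if-≤ᵇ k≤2n) (entry-upper R 2n∸k<n)
  where
  2n∸k<n : 2 ℕ.* n ∸ k < n
  2n∸k<n = subst (2 ℕ.* n ∸ k <_) (trans (ℕ.m+n∸m≡n n (n ℕ.+ 0)) (ℕ.+-identityʳ n))
                 (ℕ.∸-monoʳ-< n<k k≤2n)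

horizontalHalf-upper : ∀ R {n k} → n < k → horizontalHalf (entry R) n k ≡ 0ℤ
horizontalHalf-upper R {n} n<k =
  entry-upper R (ℕ.+-monoʳ-< n (subst (_< _) (sym (ℕ.+-identityʳ n)) n<k))

elim-by-diagonal : ∀ {P : ℕ → ℕ → Set} →
                   (∀ {n k} → n < k → P n k) → (∀ m k → P (k ℕ.+ m) k) → ∀ n k → P n k
elim-by-diagonal {P} above below n k with k ≤? n
... | no  k≰n = above (ℕ.≰⇒> k≰n)
... | yes k≤n = subst (λ n → P n k) (ℕ.m+[n∸m]≡n k≤n) (below (n ∸ k) k)

entry-⟨1,xS⊛h⟩ : ∀ (h : PS) k m → entry ⟨ oneS , xS ⊛ h ⟩ (k ℕ.+ m) k ≡ (h ^ˢ k) m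
entry-⟨1,xS⊛h⟩ h k m = begin
  entry ⟨ oneS , xS ⊛ h ⟩ (k ℕ.+ m) k       ≡⟨ if-≤ᵇ (ℕ.m≤m+n k m) ⟩
  (oneS ⊛ (xS ⊛ h) ^ˢ k) (k ℕ.+ m)          ≡⟨ ⊛-identityˡ ((xS ⊛ h) ^ˢ k) (k ℕ.+ m) ⟩
  ((xS ⊛ h) ^ˢ k) (k ℕ.+ m)                 ≡⟨ xS⊛h^ˢ-shift h k m ⟩
  (h ^ˢ k) m                                ∎

g₂ f₂ : PS
g₂ = oneMinus2x ⊛ geom
f₂ = xS ⊛ geom

-- g₂ and f₂ are partial sums of the coefficients of 1 - 2x and x, which vanish beyond degree 1.
g₂+f₂≗oneS : g₂ +ˢ f₂ ≗ oneS
g₂+f₂≗oneS zero          = refl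
g₂+f₂≗oneS (suc zero)    = refl
g₂+f₂≗oneS (suc (suc n)) =
  trans (cong₂ _+_ (ℤ.+-identityʳ (g₂ (suc n))) (ℤ.+-identityʳ (f₂ (suc n)))) (g₂+f₂≗oneS (suc n))

pascal : ℕ → ℕ → ℤ
pascal n k = (f₂ ^ˢ k) n

pascal-rec : ∀ n k → pascal (suc n) (suc k) ≡ pascal n k + pascal n (suc k)
pascal-rec zero k = begin
  pascal 1 (suc k)   ≡⟨ [xS⊛h]⊛g-suc geom (f₂ ^ˢ k) 0 ⟩
  1ℤ * pascal 0 k    ≡⟨ ℤ.*-identityˡ (pascal 0 k) ⟩
  pascal 0 k         ≡⟨ ℤ.+-identityʳ (pascal 0 k) ⟨
  pascal 0 k + 0ℤ    ∎
pascal-rec (suc n) k = begin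
  pascal (suc (suc n)) (suc k)
    ≡⟨ [xS⊛h]⊛g-suc geom (f₂ ^ˢ k) (suc n) ⟩
  (geom ⊛ f₂ ^ˢ k) (suc n)
    ≡⟨ geom⊛-suc (f₂ ^ˢ k) n ⟩
  pascal (suc n) k + (geom ⊛ f₂ ^ˢ k) n
    ≡⟨ cong (_+_ (pascal (suc n) k)) ([xS⊛h]⊛g-suc geom (f₂ ^ˢ k) n) ⟨
  pascal (suc n) k + pascal (suc n) (suc k) ∎

pascal-C : ∀ n k → pascal (suc n) (suc k) ≡ + (n C k)
pascal-C zero    zero    = refl
pascal-C zero    (suc k) = refl
pascal-C (suc n) zero    = trans (pascal-rec (suc n) 0) (cong (_+_ 0ℤ) (pascal-C n 0))
pascal-C (suc n) (suc k) = begin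
  pascal (suc (suc n)) (suc (suc k))
    ≡⟨ pascal-rec (suc n) (suc k) ⟩
  pascal (suc n) (suc k) + pascal (suc n) (suc (suc k))
    ≡⟨ cong₂ _+_ (pascal-C n k) (pascal-C n (suc k)) ⟩
  + (n C k) + + (n C suc k)
    ≡⟨ ℤ.pos-+ (n C k) (n C suc k) ⟨
  + (n C k ℕ.+ n C suc k)
    ≡⟨ cong +_ (nCk+nC[k+1]≡[n+1]C[k+1] n k) ⟩
  + (suc n C suc k) ∎

t : ℕ → ℕ → ℤ
t n k = (g₂ ⊛ f₂ ^ˢ k) n

[i+j]-j≡i : ∀ i j → (i + j) - j ≡ i
[i+j]-j≡i = ℤ-solve-∀

t+pascal≡pascal : ∀ n k → t n k + pascal n (suc k) ≡ pascal n k
t+pascal≡pascal n k = begin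
  (g₂ ⊛ f₂ ^ˢ k) n + (f₂ ⊛ f₂ ^ˢ k) n   ≡⟨ ⊛-distribʳ-+ˢ g₂ f₂ (f₂ ^ˢ k) n ⟨
  ((g₂ +ˢ f₂) ⊛ f₂ ^ˢ k) n              ≡⟨ ⊛-congʳ (f₂ ^ˢ k) g₂+f₂≗oneS n ⟩
  (oneS ⊛ f₂ ^ˢ k) n                    ≡⟨ ⊛-identityˡ (f₂ ^ˢ k) n ⟩
  pascal n k                            ∎

t≡pascal-pascal : ∀ n k → t n k ≡ pascal n k - pascal n (suc k)
t≡pascal-pascal n k = begin
  t n k                                          ≡⟨ [i+j]-j≡i (t n k) (pascal n (suc k)) ⟨
  (t n k + pascal n (suc k)) - pascal n (suc k)  ≡⟨ cong (_- pascal n (suc k)) (t+pascal≡pascal n k) ⟩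
  pascal n k - pascal n (suc k)                  ∎

t-pascal : ∀ n k → t (suc n) (suc k) ≡ t n k + t n (suc k)
t-pascal n k = begin
  t (suc n) (suc k)
    ≡⟨ t≡pascal-pascal (suc n) (suc k) ⟩
  pascal (suc n) (suc k) - pascal (suc n) (suc (suc k))
    ≡⟨ cong₂ _-_ (pascal-rec n k) (pascal-rec n (suc k)) ⟩
  (pascal n k + pascal n (suc k)) - (pascal n (suc k) + pascal n (suc (suc k)))
    ≡⟨ telescope (pascal n k) (pascal n (suc k)) (pascal n (suc (suc k))) ⟩
  (pascal n k - pascal n (suc k)) + (pascal n (suc k) - pascal n (suc (suc k)))
    ≡⟨ cong₂ _+_ (t≡pascal-pascal n k) (t≡pascal-pascal n (suc k)) ⟨
  t n k + t n (suc k) ∎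
  where
  telescope : ∀ a b c → (a + b) - (b + c) ≡ (a - b) + (b - c)
  telescope = ℤ-solve-∀

t-suc : ∀ n k → t (suc n) (suc k) ≡ + (n C k) - + (n C suc k)
t-suc n k = trans (t≡pascal-pascal (suc n) (suc k)) (cong₂ _-_ (pascal-C n k) (pascal-C n (suc k)))

t-diag : ∀ r → t r r ≡ 1ℤ
t-diag zero    = refl
t-diag (suc r) = trans (t-suc r r) (cong₂ (λ a b → + a - + b) (nCn≡1 r) (k>n⇒nCk≡0 (ℕ.n<1+n r)))

t-central : ∀ m → t (suc m ℕ.+ suc m) (suc m) ≡ 0ℤ
t-central m = begin
  t (suc m ℕ.+ suc m) (suc m)          ≡⟨ t-suc (m ℕ.+ suc m) m ⟩
  + (n C m) - + (n C suc m)            ≡⟨ cong (λ a → + a - + (n C suc m)) symmetry ⟩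
  + (n C suc m) - + (n C suc m)        ≡⟨ ℤ.+-inverseʳ (+ (n C suc m)) ⟩
  0ℤ                                   ∎
  where
  n = m ℕ.+ suc m
  symmetry : n C m ≡ n C suc m
  symmetry = trans (nCk≡nC[n∸k] (ℕ.m≤m+n m (suc m))) (cong (n C_) (ℕ.m+n∸m≡n m (suc m)))

ballot : ℕ → ℕ → ℤ
ballot zero    r       = 1ℤ
ballot (suc m) zero    = 0ℤ
ballot (suc m) (suc r) = ballot (suc m) r + ballot m (suc (suc r))

t-ballot : ∀ m r → t (r ℕ.+ (m ℕ.+ m)) (r ℕ.+ m) ≡ ballot m r
t-ballot zero    r       = trans (cong₂ t (ℕ.+-identityʳ r) (ℕ.+-identityʳ r)) (t-diag r)
t-ballot (suc m) zero    = t-central m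
t-ballot (suc m) (suc r) = begin
  t (suc row) (suc col)              ≡⟨ t-pascal row col ⟩
  t row col + t row (suc col)        ≡⟨ cong (_+_ (t row col)) (cong₂ t (rowIndex r m) (cong suc (ℕ.+-suc r m))) ⟩
  t row col + t (suc (suc r) ℕ.+ (m ℕ.+ m)) (suc (suc r) ℕ.+ m)
                                     ≡⟨ cong₂ _+_ (t-ballot (suc m) r) (t-ballot m (suc (suc r))) ⟩
  ballot (suc m) r + ballot m (suc (suc r)) ∎
  where
  row = r ℕ.+ (suc m ℕ.+ suc m)
  col = r ℕ.+ suc m
  rowIndex : ∀ r m → r ℕ.+ (suc m ℕ.+ suc m) ≡ suc (suc r) ℕ.+ (m ℕ.+ m)
  rowIndex = ℕ-solve-∀

column : ℕ → PS
column r m = ballot m r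

column-zero : column 0 ≗ oneS
column-zero zero    = refl
column-zero (suc _) = refl

column-suc : ∀ r → column (suc r) ≗ column r +ˢ xS ⊛ column (suc (suc r))
column-suc r zero    = refl
column-suc r (suc m) = cong (_+_ (ballot (suc m) r)) (sym (xS⊛-suc (column (suc (suc r))) m))

column-⊛ : ∀ r s → column r ⊛ column s ≗ column (r ℕ.+ s)
column-⊛ zero    s m       = trans (⊛-congʳ (column s) column-zero m) (⊛-identityˡ (column s) m)
column-⊛ (suc r) s zero    = refl
column-⊛ (suc r) s (suc m) = begin
  (column (suc r) ⊛ column s) (suc m)
    ≡⟨ ⊛-congʳ (column s) (column-suc r) (suc m) ⟩
  ((column r +ˢ xS ⊛ column (suc (suc r))) ⊛ column s) (suc m)
    ≡⟨ ⊛-distribʳ-+ˢ (column r) (xS ⊛ column (suc (suc r))) (column s) (suc m) ⟩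
  (column r ⊛ column s) (suc m) + ((xS ⊛ column (suc (suc r))) ⊛ column s) (suc m)
    ≡⟨ cong₂ _+_ (column-⊛ r s (suc m)) ([xS⊛h]⊛g-suc (column (suc (suc r))) (column s) m) ⟩
  ballot (suc m) (r ℕ.+ s) + (column (suc (suc r)) ⊛ column s) m
    ≡⟨ cong (_+_ (ballot (suc m) (r ℕ.+ s))) (column-⊛ (suc (suc r)) s m) ⟩
  ballot (suc m) (r ℕ.+ s) + ballot m (suc (suc (r ℕ.+ s))) ∎

column-^ˢ : ∀ {h : PS} r → h ≗ column r → ∀ k → h ^ˢ k ≗ column (k ℕ.* r)
column-^ˢ r h≗column zero    m = sym (column-zero m)
column-^ˢ r h≗column (suc k) m =
  trans (⊛-cong h≗column (column-^ˢ r h≗column k) m) (column-⊛ r (k ℕ.* r) m)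

[k+1]*nC[k+1]+k*nCk≡n*nCk : ∀ n k → suc k ℕ.* (n C suc k) ℕ.+ k ℕ.* (n C k) ≡ n ℕ.* (n C k)
[k+1]*nC[k+1]+k*nCk≡n*nCk zero    zero    = refl
[k+1]*nC[k+1]+k*nCk≡n*nCk zero    (suc k) = cong₂ ℕ._+_ (ℕ.*-zeroʳ (suc (suc k))) (ℕ.*-zeroʳ (suc k))
[k+1]*nC[k+1]+k*nCk≡n*nCk (suc n) zero    =
  trans (cong (λ x → 1 ℕ.* x ℕ.+ 0) (nC1≡n (suc n))) (trans (ℕ.+-identityʳ _) (ℕ.*-comm 1 (suc n)))
[k+1]*nC[k+1]+k*nCk≡n*nCk (suc n) (suc k) = begin
  suc (suc k) ℕ.* (suc n C suc (suc k)) ℕ.+ suc k ℕ.* (suc n C suc k)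
    ≡⟨ cong₂ (λ x y → suc (suc k) ℕ.* x ℕ.+ suc k ℕ.* y)
             (sym (nCk+nC[k+1]≡[n+1]C[k+1] n (suc k))) (sym (nCk+nC[k+1]≡[n+1]C[k+1] n k)) ⟩
  suc (suc k) ℕ.* (b ℕ.+ c) ℕ.+ suc k ℕ.* (a ℕ.+ b)
    ≡⟨ regroup k a b c ⟩
  (suc (suc k) ℕ.* c ℕ.+ suc k ℕ.* b) ℕ.+ (suc k ℕ.* b ℕ.+ k ℕ.* a) ℕ.+ (a ℕ.+ b)
    ≡⟨ cong₂ (λ x y → x ℕ.+ y ℕ.+ (a ℕ.+ b))
             ([k+1]*nC[k+1]+k*nCk≡n*nCk n (suc k)) ([k+1]*nC[k+1]+k*nCk≡n*nCk n k) ⟩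
  n ℕ.* b ℕ.+ n ℕ.* a ℕ.+ (a ℕ.+ b)
    ≡⟨ collect n a b ⟩
  suc n ℕ.* (a ℕ.+ b)
    ≡⟨ cong (suc n ℕ.*_) (nCk+nC[k+1]≡[n+1]C[k+1] n k) ⟩
  suc n ℕ.* (suc n C suc k) ∎
  where
  a = n C k
  b = n C suc k
  c = n C suc (suc k)
  regroup : ∀ k a b c → suc (suc k) ℕ.* (b ℕ.+ c) ℕ.+ suc k ℕ.* (a ℕ.+ b)
          ≡ (suc (suc k) ℕ.* c ℕ.+ suc k ℕ.* b) ℕ.+ (suc k ℕ.* b ℕ.+ k ℕ.* a) ℕ.+ (a ℕ.+ b)
  regroup = ℕ-solve-∀
  collect : ∀ n a b → n ℕ.* b ℕ.+ n ℕ.* a ℕ.+ (a ℕ.+ b) ≡ suc n ℕ.* (a ℕ.+ b)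
  collect = ℕ-solve-∀

m/[1+n]+k≡m : ∀ m n k → suc n ℕ.* k ≡ n ℕ.* m → m / suc n ℕ.+ k ≡ m
m/[1+n]+k≡m m n k [1+n]k≡nm = trans (cong (ℕ._+ k) m/[1+n]≡m∸k) (ℕ.m∸n+n≡m k≤m)
  where
  k≤m : k ≤ m
  k≤m = ℕ.*-cancelˡ-≤ (suc n) (subst (_≤ suc n ℕ.* m) (sym [1+n]k≡nm) (ℕ.m≤n+m (n ℕ.* m) m))
  [m∸k][1+n]≡m : (m ∸ k) ℕ.* suc n ≡ m
  [m∸k][1+n]≡m = begin
    (m ∸ k) ℕ.* suc n             ≡⟨ ℕ.*-distribʳ-∸ (suc n) m k ⟩
    m ℕ.* suc n ∸ k ℕ.* suc n     ≡⟨ cong₂ _∸_ (ℕ.*-comm m (suc n)) (trans (ℕ.*-comm k (suc n)) [1+n]k≡nm) ⟩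
    m ℕ.+ n ℕ.* m ∸ n ℕ.* m       ≡⟨ ℕ.m+n∸n≡m m (n ℕ.* m) ⟩
    m                             ∎
  m/[1+n]≡m∸k : m / suc n ≡ m ∸ k
  m/[1+n]≡m∸k = trans (cong (_/ suc n) (sym [m∸k][1+n]≡m)) (m*n/n≡m (m ∸ k) (suc n))

catalan+C[2n,n+1]≡C[2n,n] : ∀ n → catalan n ℕ.+ (2 ℕ.* n) C suc n ≡ (2 ℕ.* n) C n
catalan+C[2n,n+1]≡C[2n,n] n = m/[1+n]+k≡m ((2 ℕ.* n) C n) n ((2 ℕ.* n) C suc n) centralAbsorption
  where
  double : ∀ n x → 2 ℕ.* n ℕ.* x ≡ n ℕ.* x ℕ.+ n ℕ.* x
  double = ℕ-solve-∀
  centralAbsorption : suc n ℕ.* ((2 ℕ.* n) C suc n) ≡ n ℕ.* ((2 ℕ.* n) C n)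
  centralAbsorption = ℕ.+-cancelʳ-≡ _ _ (n ℕ.* ((2 ℕ.* n) C n))
    (trans ([k+1]*nC[k+1]+k*nCk≡n*nCk (2 ℕ.* n) n) (double n ((2 ℕ.* n) C n)))

catalan≡C[2n,n]-C[2n,n+1] : ∀ n → + catalan n ≡ + ((2 ℕ.* n) C n) - + ((2 ℕ.* n) C suc n)
catalan≡C[2n,n]-C[2n,n+1] n = begin
  + catalan n                    ≡⟨ [i+j]-j≡i (+ catalan n) (+ Y) ⟨
  + catalan n + + Y - + Y        ≡⟨ cong (_- + Y) (ℤ.pos-+ (catalan n) Y) ⟨
  + (catalan n ℕ.+ Y) - + Y      ≡⟨ cong (λ x → + x - + Y) (catalan+C[2n,n+1]≡C[2n,n] n) ⟩
  + ((2 ℕ.* n) C n) - + Y        ∎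
  where
  Y = (2 ℕ.* n) C suc n

cS≗column1 : cS ≗ column 1
cS≗column1 n = begin
  + catalan n                                       ≡⟨ catalan≡C[2n,n]-C[2n,n+1] n ⟩
  + ((2 ℕ.* n) C n) - + ((2 ℕ.* n) C suc n)         ≡⟨ cong (λ m → + (m C n) - + (m C suc n)) 2n≡n+n ⟩
  + ((n ℕ.+ n) C n) - + ((n ℕ.+ n) C suc n)         ≡⟨ t-suc (n ℕ.+ n) n ⟨
  t (suc (n ℕ.+ n)) (suc n)                         ≡⟨ t-ballot n 1 ⟩
  ballot n 1                                        ∎
  where
  2n≡n+n : 2 ℕ.* n ≡ n ℕ.+ n
  2n≡n+n = cong (n ℕ.+_) (ℕ.+-identityʳ n)

entry-M₂-ballot : ∀ m r → entry M₂ (r ℕ.+ (m ℕ.+ m)) (r ℕ.+ m) ≡ ballot m r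
entry-M₂-ballot m r = trans (if-≤ᵇ (ℕ.+-monoʳ-≤ r (ℕ.m≤m+n m m))) (t-ballot m r)

verticalHalf-M₂ : ∀ m k → verticalHalf (entry M₂) (k ℕ.+ m) k ≡ ballot m k
verticalHalf-M₂ m k = begin
  verticalHalf (entry M₂) (k ℕ.+ m) k          ≡⟨ if-≤ᵇ (subst (k ≤_) (sym (twice k m)) (ℕ.m≤m+n k _)) ⟩
  entry M₂ (2 ℕ.* (k ℕ.+ m) ∸ k) (k ℕ.+ m)     ≡⟨ cong (λ i → entry M₂ i (k ℕ.+ m)) rowIndex ⟩
  entry M₂ (k ℕ.+ (m ℕ.+ m)) (k ℕ.+ m)         ≡⟨ entry-M₂-ballot m k ⟩
  ballot m k                                   ∎
  where
  twice : ∀ k m → 2 ℕ.* (k ℕ.+ m) ≡ k ℕ.+ (k ℕ.+ (m ℕ.+ m))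
  twice = ℕ-solve-∀
  rowIndex : 2 ℕ.* (k ℕ.+ m) ∸ k ≡ k ℕ.+ (m ℕ.+ m)
  rowIndex = trans (cong (_∸ k) (twice k m)) (ℕ.m+n∸m≡n k _)

horizontalHalf-M₂ : ∀ m k → horizontalHalf (entry M₂) (k ℕ.+ m) k ≡ ballot m (k ℕ.* 2)
horizontalHalf-M₂ m k =
  trans (cong₂ (entry M₂) (rowIndex k m) (columnIndex k m)) (entry-M₂-ballot m (k ℕ.* 2))
  where
  rowIndex : ∀ k m → 2 ℕ.* (k ℕ.+ m) ≡ k ℕ.* 2 ℕ.+ (m ℕ.+ m)
  rowIndex = ℕ-solve-∀
  columnIndex : ∀ k m → k ℕ.+ m ℕ.+ k ≡ k ℕ.* 2 ℕ.+ m
  columnIndex = ℕ-solve-∀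

entry-V₂ : ∀ m k → entry V₂ (k ℕ.+ m) k ≡ ballot m k
entry-V₂ m k = begin
  entry V₂ (k ℕ.+ m) k    ≡⟨ entry-⟨1,xS⊛h⟩ cS k m ⟩
  (cS ^ˢ k) m             ≡⟨ column-^ˢ 1 cS≗column1 k m ⟩
  ballot m (k ℕ.* 1)      ≡⟨ cong (ballot m) (ℕ.*-identityʳ k) ⟩
  ballot m k              ∎

entry-H₂ : ∀ m k → entry H₂ (k ℕ.+ m) k ≡ ballot m (k ℕ.* 2)
entry-H₂ m k = trans (entry-⟨1,xS⊛h⟩ (cS ⊛ cS) k m) (column-^ˢ 2 cS⊛cS≗column2 k m)
  where
  cS⊛cS≗column2 : cS ⊛ cS ≗ column 2
  cS⊛cS≗column2 i = trans (⊛-cong cS≗column1 cS≗column1 i) (column-⊛ 1 1 i)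

mainTheorem10 : ((n k : ℕ) → verticalHalf (entry M₂) n k ≡ entry V₂ n k)
                × ((n k : ℕ) → horizontalHalf (entry M₂) n k ≡ entry H₂ n k)
mainTheorem10 =
  elim-by-diagonal (λ n<k → trans (verticalHalf-upper M₂ n<k) (sym (entry-upper V₂ n<k)))
                   (λ m k → trans (verticalHalf-M₂ m k) (sym (entry-V₂ m k))) ,
  elim-by-diagonal (λ n<k → trans (horizontalHalf-upper M₂ n<k) (sym (entry-upper H₂ n<k)))
                   (λ m k → trans (horizontalHalf-M₂ m k) (sym (entry-H₂ m k)))
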